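{- Let $n\ge1$ and let $\mathcal K_n$ be the $(Q,T)$-Kostka matrix, indexed by compositions of $n$, with $(\mathcal K_n)_{IJ}=\prod_{d\in\mathrm{Des}(J)}z_d(I)$. Then $$(\mathcal K_n^{ -1})_{IJ}=(-1)^{\ell(I)-1}\prod_{d\in\mathrm{Des}(\bar I^\sim)}z'_d(J)\ \prod_{p=1}^{n-1}\frac1{z'_p(J)-z_p(J)}.$$
   Context: $Q=(q_{ij})$, $T=(t_{ij})$ are infinite matrices of commuting indeterminates. For a composition $I=(i_1,\dots,i_r)$ of $n$, $\ell(I)=r$, $\mathrm{Des}(I)=\{i_1,i_1+i_2,\dots,i_1+\dots+i_{r-1}\}$, and $I$ is encoded by the boolean word $u_1\cdots u_{n-1}$ with $u_k=1$ iff $k\in\mathrm{Des}(I)$. For $1\le k\le n-1$ let $a$ (resp. $b$) be the number of $1$'s (resp. $0$'s) in $u_1\cdots u_{k-1}$; $z_k(I)=q_{a+1,b+1}$ if $u_k=0$ and $t_{a+1,b+1}$ if $u_k=1$. $z'_k(I)$ is obtained from $z_k(I)$ by exchanging $q$ and $t$ (i.e. $z'_k(I)=t_{a+1,b+1}$ if $u_k=0$, $q_{a+1,b+1}$ if $u_k=1$). $\bar I^\sim$ is the conjugate of the mirror image of $I$, the composition with $\mathrm{Des}(\bar I^\sim)=\{1,\dots,n-1\}\setminus\mathrm{Des}(I)$. $\mathcal K_n$ is the Kostka matrix of the noncommutative $(Q,T)$-Macdonald functions $\tilde H_I=\sum_J(\mathcal K_n)_{IJ}R_J$, $R_J$ ribbons.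 -}

module Defs where

open import Level using (Level)
open import Data.Nat using (ℕ; zero; suc)
open import Data.Bool using (Bool; true; false; if_then_else_)
open import Data.Vec using (Vec; []; _∷_)
open import Data.List using (List; []; _∷_; map; _++_)
open import Algebra.Bundles using (CommutativeRing)

-- A composition I of n = suc m is encoded (bijectively) by its boolean
-- word u₁ ⋯ u_m  (u_k = true iff k ∈ Des(I)).
Composition : ℕ → Set
Composition (suc m) = Vec Bool m
Composition zero    = Vec Bool zero  -- unused (n ≥ 1)

allWords : (m : ℕ) → List (Vec Bool m)
allWords zero    = [] ∷ []
allWords (suc m) = map (false ∷_) (allWords m) ++ map (true ∷_) (allWords m)

eqW : ∀ {m} → Vec Bool m → Vec Bool m → Bool
eqW []            []            = true
eqW (true ∷ u)    (true ∷ v)    = eqW u v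
eqW (false ∷ u)   (false ∷ v)   = eqW u v
eqW (true ∷ u)    (false ∷ v)   = false
eqW (false ∷ u)   (true ∷ v)    = false

-- number of 1's in a word ( = ℓ(I) - 1 )
ones : ∀ {m} → Vec Bool m → ℕ
ones []          = zero
ones (true ∷ u)  = suc (ones u)
ones (false ∷ u) = ones u

module _ {c ℓ : Level} (R : CommutativeRing c ℓ) where
  open CommutativeRing R hiding (zero)

  -- zAux q t a b u : the vector (z_k)_k where a, b count the 1's / 0's
  -- already read.  Indeterminates q_{ij}, t_{ij} (i, j ≥ 1) are values
  -- q i j, t i j (index 0 unused).
  zAux : ∀ {m} → (ℕ → ℕ → Carrier) → (ℕ → ℕ → Carrier) →
         ℕ → ℕ → Vec Bool m → Vec Carrier m
  zAux q t a b []          = []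
  zAux q t a b (false ∷ u) = q (suc a) (suc b) ∷ zAux q t a (suc b) u
  zAux q t a b (true ∷ u)  = t (suc a) (suc b) ∷ zAux q t (suc a) b u

  zVec : ∀ {m} → (ℕ → ℕ → Carrier) → (ℕ → ℕ → Carrier) → Vec Bool m → Vec Carrier m
  zVec q t u = zAux q t zero zero u

  z'Vec : ∀ {m} → (ℕ → ℕ → Carrier) → (ℕ → ℕ → Carrier) → Vec Bool m → Vec Carrier m
  z'Vec q t u = zAux t q zero zero u

  prodSel : ∀ {m} → Vec Bool m → Vec Carrier m → Carrier
  prodSel []          []       = 1#
  prodSel (true ∷ s)  (x ∷ xs) = x * prodSel s xs
  prodSel (false ∷ s) (x ∷ xs) = prodSel s xs

  prodSelC : ∀ {m} → Vec Bool m → Vec Carrier m → Carrier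
  prodSelC []          []       = 1#
  prodSelC (true ∷ s)  (x ∷ xs) = prodSelC s xs
  prodSelC (false ∷ s) (x ∷ xs) = x * prodSelC s xs

  prodDiff : ∀ {m} → Vec Carrier m → Vec Carrier m → Carrier
  prodDiff []       []       = 1#
  prodDiff (x ∷ xs) (y ∷ ys) = (x - y) * prodDiff xs ys

  signPow : ℕ → Carrier
  signPow zero    = 1#
  signPow (suc k) = (- 1#) * signPow k

  sumList : List Carrier → Carrier
  sumList []       = 0#
  sumList (x ∷ xs) = x + sumList xs

  Kostka : ∀ {m} → (q t : ℕ → ℕ → Carrier) → Vec Bool m → Vec Bool m → Carrier
  Kostka q t I J = prodSel J (zVec q t I)

  -- numerator  (-1)^{ℓ(I)-1} ∏_{d ∈ Des(Ī~)} z'_d(J);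
  -- Des(Ī~) = complement of Des(I), i.e. positions where I has a 0.
  invNum : ∀ {m} → (q t : ℕ → ℕ → Carrier) → Vec Bool m → Vec Bool m → Carrier
  invNum q t I J = signPow (ones I) * prodSelC I (z'Vec q t J)

  invDen : ∀ {m} → (q t : ℕ → ℕ → Carrier) → Vec Bool m → Carrier
  invDen q t J = prodDiff (z'Vec q t J) (zVec q t J)

  δ : ∀ {m} → Vec Bool m → Vec Bool m → Carrier
  δ I J = if eqW I J then 1# else 0#

  matMul : (m : ℕ) → (Vec Bool m → Vec Bool m → Carrier) →
           (Vec Bool m → Vec Bool m → Carrier) → Vec Bool m → Vec Bool m → Carrier
  matMul m A B I J = sumList (map (λ L → A I L * B L J) (allWords m))

-- The first letter i of I moves
-- the counters (a, b) of 1's and 0's read so far, and the first letter j of J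
-- selects whether the factor z_i = z_1(I) enters, so the Kostka matrix is the
-- block matrix [[K₀, z₀ K₀], [K₁, z₁ K₁]], the K_i being Kostka matrices with
-- shifted counters. Likewise the claimed inverse is
-- [[z₁ e₀ M₀, z₀ e₁ M₁], [- e₀ M₀, - e₁ M₁]] with e₀ = 1/(z₁ - z₀), e₁ = 1/(z₀ - z₁)
-- and M_j the claimed inverse for shifted counters. Block multiplication
-- reduces both products to induction and to the mutual inverseness of the
-- 2 × 2 matrices [[1, z₀], [1, z₁]] and [[z₁ e₀, z₀ e₁], [- e₀, - e₁]],
-- which holds because e₁ = - e₀.
module Submission where

open import Defs
open import Level using (Level)
open import Data.Nat using (ℕ; zero; suc)
open import Data.Bool using (Bool; true; false; not)
open import Data.Vec using (Vec; []; _∷_; replicate)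
open import Data.List using (List; []; _∷_; map; _++_)
open import Data.List.Properties using (map-++; map-∘)
open import Data.Product using (_×_; _,_; proj₁; proj₂)
open import Function using (_∘_)
open import Algebra.Bundles using (CommutativeRing)
import Algebra.Properties.Ring as RingProperties
import Algebra.Properties.CommutativeSemigroup as CommutativeSemigroupProperties
import Relation.Binary.PropositionalEquality as ≡
import Relation.Binary.Reasoning.Setoid as SetoidReasoning

module _ {c ℓ : Level} (R : CommutativeRing c ℓ) where
  open CommutativeRing R hiding (zero)
  open RingProperties ring
    using (-1*x≈-x; -‿distribˡ-*; -‿distribʳ-*; -‿involutive; [y-z]x≈yx-zx; ⁻¹-anti-homo‿-; -‿+-comm; -0#≈0#)
  open CommutativeSemigroupProperties *-commutativeSemigroup
    using (interchange; x∙yz≈y∙xz; x∙yz≈yx∙z; xy∙z≈yz∙x; xy∙z≈zx∙y; xy∙z≈xz∙y)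
  open SetoidReasoning setoid

  Matrix : ℕ → Set c
  Matrix m = Vec Bool m → Vec Bool m → Carrier

  Inverses : (m : ℕ) → Matrix m → Matrix m → Set ℓ
  Inverses m A B = (∀ I J → matMul R m A B I J ≈ δ R I J) × (∀ I J → matMul R m B A I J ≈ δ R I J)

  sumList-++ : (xs ys : List Carrier) → sumList R (xs ++ ys) ≈ sumList R xs + sumList R ys
  sumList-++ []       ys = sym (+-identityˡ _)
  sumList-++ (x ∷ xs) ys = trans (+-congˡ (sumList-++ xs ys)) (sym (+-assoc _ _ _))

  sumList-cong : {X : Set} {f g : X → Carrier} → (∀ x → f x ≈ g x) →
                 (xs : List X) → sumList R (map f xs) ≈ sumList R (map g xs)
  sumList-cong f≈g []       = refl
  sumList-cong f≈g (x ∷ xs) = +-cong (f≈g x) (sumList-cong f≈g xs)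

  sumList-*ˡ : {X : Set} (k : Carrier) (f : X → Carrier) (xs : List X) →
               sumList R (map (λ x → k * f x) xs) ≈ k * sumList R (map f xs)
  sumList-*ˡ k f []       = sym (zeroʳ k)
  sumList-*ˡ k f (x ∷ xs) = trans (+-congˡ (sumList-*ˡ k f xs)) (sym (distribˡ k _ _))

  Σᵇ : (Bool → Carrier) → Carrier
  Σᵇ f = f false + f true

  sumWords-suc : (m : ℕ) (f : Vec Bool (suc m) → Carrier) →
                 sumList R (map f (allWords (suc m))) ≈ Σᵇ (λ l → sumList R (map (f ∘ (l ∷_)) (allWords m)))
  sumWords-suc m f = begin
    sumList R (map f (map (false ∷_) W ++ map (true ∷_) W))
      ≡⟨ ≡.cong (sumList R) (map-++ f (map (false ∷_) W) (map (true ∷_) W)) ⟩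
    sumList R (map f (map (false ∷_) W) ++ map f (map (true ∷_) W))
      ≈⟨ sumList-++ (map f (map (false ∷_) W)) (map f (map (true ∷_) W)) ⟩
    sumList R (map f (map (false ∷_) W)) + sumList R (map f (map (true ∷_) W))
      ≡⟨ ≡.sym (≡.cong₂ (λ xs ys → sumList R xs + sumList R ys) (map-∘ W) (map-∘ W)) ⟩
    Σᵇ (λ l → sumList R (map (f ∘ (l ∷_)) W)) ∎
    where W = allWords m

  matMul-∷ : ∀ {m} (A B : Matrix (suc m)) (α β : Bool → Bool → Carrier) (A′ B′ : Bool → Bool → Matrix m) →
             (∀ i l I L → A (i ∷ I) (l ∷ L) ≈ α i l * A′ i l I L) →
             (∀ l j L J → B (l ∷ L) (j ∷ J) ≈ β l j * B′ l j L J) →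
             ∀ i j I J → matMul R (suc m) A B (i ∷ I) (j ∷ J) ≈
                         Σᵇ (λ l → (α i l * β l j) * matMul R m (A′ i l) (B′ l j) I J)
  matMul-∷ {m} A B α β A′ B′ A-blocks B-blocks i j I J = begin
    matMul R (suc m) A B (i ∷ I) (j ∷ J)
      ≈⟨ sumWords-suc m _ ⟩
    Σᵇ (λ l → sumList R (map (λ L → A (i ∷ I) (l ∷ L) * B (l ∷ L) (j ∷ J)) (allWords m)))
      ≈⟨ +-cong (block false) (block true) ⟩
    Σᵇ (λ l → (α i l * β l j) * matMul R m (A′ i l) (B′ l j) I J) ∎
    where
    block : ∀ l → sumList R (map (λ L → A (i ∷ I) (l ∷ L) * B (l ∷ L) (j ∷ J)) (allWords m))
                  ≈ (α i l * β l j) * matMul R m (A′ i l) (B′ l j) I J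
    block l = trans
      (sumList-cong (λ L → trans (*-cong (A-blocks i l I L) (B-blocks l j L J)) (interchange _ _ _ _)) (allWords m))
      (sumList-*ˡ _ _ (allWords m))

  inverses-[] : (A B : Matrix 0) → A [] [] * B [] [] ≈ 1# → Inverses 0 A B
  inverses-[] A B AB≈1 = (λ { [] [] → trans (+-identityʳ _) AB≈1 })
                       , (λ { [] [] → trans (+-identityʳ _) (trans (*-comm _ _) AB≈1) })

  δ₂ : Bool → Bool → Carrier
  δ₂ false false = 1#
  δ₂ true  true  = 1#
  δ₂ false true  = 0#
  δ₂ true  false = 0#

  _·₂_ : (Bool → Bool → Carrier) → (Bool → Bool → Carrier) → Bool → Bool → Carrier
  (α ·₂ β) i j = Σᵇ (λ l → α i l * β l j)

  Inverses₂ : (Bool → Bool → Carrier) → (Bool → Bool → Carrier) → Set ℓ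
  Inverses₂ α β = (∀ i j → (α ·₂ β) i j ≈ δ₂ i j) × (∀ i j → (β ·₂ α) i j ≈ δ₂ i j)

  δ₂-∷ : ∀ {m} {I J : Vec Bool m} (X : Bool → Bool → Carrier) → (∀ i → X i i ≈ δ R I J) →
         ∀ i j → δ₂ i j * X i j ≈ δ R (i ∷ I) (j ∷ J)
  δ₂-∷ X diag false false = trans (*-identityˡ _) (diag false)
  δ₂-∷ X diag true  true  = trans (*-identityˡ _) (diag true)
  δ₂-∷ X diag false true  = zeroˡ _
  δ₂-∷ X diag true  false = zeroˡ _

  inverses-∷ : ∀ {m} (A B : Matrix (suc m)) (α β : Bool → Bool → Carrier) (A′ B′ : Bool → Matrix m) →
               (∀ i l I L → A (i ∷ I) (l ∷ L) ≈ α i l * A′ i I L) →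
               (∀ l j L J → B (l ∷ L) (j ∷ J) ≈ β l j * B′ j L J) →
               Inverses₂ α β → (∀ i → Inverses m (A′ i) (B′ i)) → Inverses (suc m) A B
  inverses-∷ {m} A B α β A′ B′ A-blocks B-blocks (αβ≈δ , βα≈δ) blocks-inverse = AB≈δ , BA≈δ
    where
    AB≈δ : ∀ I J → matMul R (suc m) A B I J ≈ δ R I J
    AB≈δ (i ∷ I) (j ∷ J) = begin
      matMul R (suc m) A B (i ∷ I) (j ∷ J)
        ≈⟨ matMul-∷ A B α β (λ i _ → A′ i) (λ _ j → B′ j) A-blocks B-blocks i j I J ⟩
      Σᵇ (λ l → (α i l * β l j) * matMul R m (A′ i) (B′ j) I J)
        ≈⟨ distribʳ _ _ _ ⟨
      (α ·₂ β) i j * matMul R m (A′ i) (B′ j) I J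
        ≈⟨ *-congʳ (αβ≈δ i j) ⟩
      δ₂ i j * matMul R m (A′ i) (B′ j) I J
        ≈⟨ δ₂-∷ (λ i j → matMul R m (A′ i) (B′ j) I J) (λ i → proj₁ (blocks-inverse i) I J) i j ⟩
      δ R (i ∷ I) (j ∷ J) ∎

    BA≈δ : ∀ I J → matMul R (suc m) B A I J ≈ δ R I J
    BA≈δ (l ∷ L) (j ∷ J) = begin
      matMul R (suc m) B A (l ∷ L) (j ∷ J)
        ≈⟨ matMul-∷ B A β α (λ _ i → B′ i) (λ i _ → A′ i) B-blocks A-blocks l j L J ⟩
      Σᵇ (λ i → (β l i * α i j) * matMul R m (B′ i) (A′ i) L J)
        ≈⟨ +-cong (*-congˡ (proj₂ (blocks-inverse false) L J)) (*-congˡ (proj₂ (blocks-inverse true) L J)) ⟩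
      Σᵇ (λ i → (β l i * α i j) * δ R L J)
        ≈⟨ distribʳ _ _ _ ⟨
      (β ·₂ α) l j * δ R L J
        ≈⟨ *-congʳ (βα≈δ l j) ⟩
      δ₂ l j * δ R L J
        ≈⟨ δ₂-∷ (λ _ _ → δ R L J) (λ _ → refl) l j ⟩
      δ R (l ∷ L) (j ∷ J) ∎

  inverse-unique : ∀ {a b d} → a * d ≈ 1# → b * d ≈ 1# → a ≈ b
  inverse-unique {a} {b} {d} ad≈1 bd≈1 = begin
    a             ≈⟨ *-identityʳ a ⟨
    a * 1#        ≈⟨ *-congˡ bd≈1 ⟨
    a * (b * d)   ≈⟨ x∙yz≈y∙xz a b d ⟩
    b * (a * d)   ≈⟨ *-congˡ ad≈1 ⟩
    b * 1#        ≈⟨ *-identityʳ b ⟩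
    b             ∎

  xe+y[-e]≈[x-y]e : ∀ x y e → x * e + y * (- e) ≈ (x - y) * e
  xe+y[-e]≈[x-y]e x y e = trans (+-congˡ (sym (-‿distribʳ-* y e))) (sym ([y-z]x≈yx-zx e x y))

  insert-unit : ∀ {e d} → e * d ≈ 1# → ∀ x y w → (x * y) * w ≈ (x * e) * (y * (d * w))
  insert-unit {e} {d} ed≈1 x y w = begin
    (x * y) * w             ≈⟨ *-congˡ (*-identityˡ w) ⟨
    (x * y) * (1# * w)      ≈⟨ *-congˡ (*-congʳ ed≈1) ⟨
    (x * y) * ((e * d) * w) ≈⟨ *-congˡ (*-assoc e d w) ⟩
    (x * y) * (e * (d * w)) ≈⟨ interchange x y e (d * w) ⟩
    (x * e) * (y * (d * w)) ∎

  kostka₂ : (Bool → Carrier) → Bool → Bool → Carrier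
  kostka₂ z i false = 1#
  kostka₂ z i true  = z i

  kostkaInverse₂ : (Bool → Carrier) → (Bool → Carrier) → Bool → Bool → Carrier
  kostkaInverse₂ z e false j = z (not j) * e j
  kostkaInverse₂ z e true  j = - e j

  kostka₂-inverse : (z e : Bool → Carrier) → (∀ j → e j * (z (not j) - z j) ≈ 1#) →
                    Inverses₂ (kostka₂ z) (kostkaInverse₂ z e)
  kostka₂-inverse z e e-inverse = κμ≈δ , μκ≈δ
    where
    e-true : e true ≈ - e false
    e-true = inverse-unique (e-inverse true) (begin
      - e false * (z false - z true)      ≈⟨ *-congˡ (⁻¹-anti-homo‿- (z true) (z false)) ⟨
      - e false * - (z true - z false)    ≈⟨ -‿distribˡ-* _ _ ⟨
      - (e false * - (z true - z false))  ≈⟨ -‿cong (-‿distribʳ-* _ _) ⟨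
      - - (e false * (z true - z false))  ≈⟨ -‿involutive _ ⟩
      e false * (z true - z false)        ≈⟨ e-inverse false ⟩
      1#                                  ∎)

    e-sum : e false + e true ≈ 0#
    e-sum = trans (+-congˡ e-true) (-‿inverseʳ _)

    κμ-entry : ∀ i j → (kostka₂ z ·₂ kostkaInverse₂ z e) i j ≈ (z (not j) - z i) * e j
    κμ-entry i j = trans (+-congʳ (*-identityˡ _)) (xe+y[-e]≈[x-y]e _ _ _)

    κμ≈δ : ∀ i j → (kostka₂ z ·₂ kostkaInverse₂ z e) i j ≈ δ₂ i j
    κμ≈δ false false = trans (κμ-entry false false) (trans (*-comm _ _) (e-inverse false))
    κμ≈δ true  true  = trans (κμ-entry true true) (trans (*-comm _ _) (e-inverse true))
    κμ≈δ false true  = trans (κμ-entry false true) (trans (*-congʳ (-‿inverseʳ _)) (zeroˡ _))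
    κμ≈δ true  false = trans (κμ-entry true false) (trans (*-congʳ (-‿inverseʳ _)) (zeroˡ _))

    μκ≈δ : ∀ l j → (kostkaInverse₂ z e ·₂ kostka₂ z) l j ≈ δ₂ l j
    μκ≈δ false false = begin
      (z true * e false) * 1# + (z false * e true) * 1#  ≈⟨ +-cong (*-identityʳ _) (*-identityʳ _) ⟩
      z true * e false + z false * e true                ≈⟨ +-congˡ (*-congˡ e-true) ⟩
      z true * e false + z false * - e false             ≈⟨ xe+y[-e]≈[x-y]e _ _ _ ⟩
      (z true - z false) * e false                       ≈⟨ *-comm _ _ ⟩
      e false * (z true - z false)                       ≈⟨ e-inverse false ⟩
      1#                                                 ∎
    μκ≈δ true true = begin
      - e false * z false + - e true * z true            ≈⟨ +-cong (*-comm _ _) (*-comm _ _) ⟩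
      z false * - e false + z true * - e true            ≈⟨ +-congʳ (*-congˡ (sym e-true)) ⟩
      z false * e true + z true * - e true               ≈⟨ xe+y[-e]≈[x-y]e _ _ _ ⟩
      (z false - z true) * e true                        ≈⟨ *-comm _ _ ⟩
      e true * (z false - z true)                        ≈⟨ e-inverse true ⟩
      1#                                                 ∎
    μκ≈δ false true = begin
      (z true * e false) * z false + (z false * e true) * z true
        ≈⟨ +-cong (xy∙z≈zx∙y _ _ _) (xy∙z≈xz∙y _ _ _) ⟩
      (z false * z true) * e false + (z false * z true) * e true
        ≈⟨ distribˡ _ _ _ ⟨
      (z false * z true) * (e false + e true)           ≈⟨ *-congˡ e-sum ⟩
      (z false * z true) * 0#                           ≈⟨ zeroʳ _ ⟩
      0#                                                ∎
    μκ≈δ true false = begin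
      - e false * 1# + - e true * 1#                    ≈⟨ +-cong (*-identityʳ _) (*-identityʳ _) ⟩
      - e false + - e true                              ≈⟨ -‿+-comm _ _ ⟩
      - (e false + e true)                              ≈⟨ -‿cong e-sum ⟩
      - 0#                                              ≈⟨ -0#≈0# ⟩
      0#                                                ∎

  module _ (q t : ℕ → ℕ → Carrier) where

    State : Set
    State = ℕ × ℕ

    step : Bool → State → State
    step false (a , b) = (a , suc b)
    step true  (a , b) = (suc a , b)

    zAt : State → Bool → Carrier
    zAt (a , b) false = q (suc a) (suc b)
    zAt (a , b) true  = t (suc a) (suc b)

    dAt : State → Bool → Carrier
    dAt s j = zAt s (not j) - zAt s j

    KostkaAt : ∀ {m} → State → Matrix m
    KostkaAt (a , b) I J = prodSel R J (zAux R q t a b I)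

    invNumAt : ∀ {m} → State → Matrix m
    invNumAt (a , b) L J = signPow R (ones L) * prodSelC R L (zAux R t q a b J)

    invDenAt : ∀ {m} → State → Vec Bool m → Carrier
    invDenAt (a , b) J = prodDiff R (zAux R t q a b J) (zAux R q t a b J)

    kostka-∷ : ∀ {m} s i j (I J : Vec Bool m) →
               KostkaAt s (i ∷ I) (j ∷ J) ≈ kostka₂ (zAt s) i j * KostkaAt (step i s) I J
    kostka-∷ s false false I J = sym (*-identityˡ _)
    kostka-∷ s true  false I J = sym (*-identityˡ _)
    kostka-∷ s false true  I J = refl
    kostka-∷ s true  true  I J = refl

    invDen-∷ : ∀ {m} s j (J : Vec Bool m) → invDenAt s (j ∷ J) ≈ dAt s j * invDenAt (step j s) J
    invDen-∷ s false J = refl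
    invDen-∷ s true  J = refl

    inverse-∷ : ∀ {m} s (inv : Vec Bool (suc m) → Carrier) (e : Bool → Carrier) →
                (∀ j → e j * dAt s j ≈ 1#) → ∀ l j (L J : Vec Bool m) →
                invNumAt s (l ∷ L) (j ∷ J) * inv (j ∷ J)
                  ≈ kostkaInverse₂ (zAt s) e l j * (invNumAt (step j s) L J * (dAt s j * inv (j ∷ J)))
    inverse-∷ s inv e e-inverse false false L J =
      trans (*-congʳ (x∙yz≈y∙xz _ _ _)) (insert-unit (e-inverse false) _ _ _)
    inverse-∷ s inv e e-inverse false true  L J =
      trans (*-congʳ (x∙yz≈y∙xz _ _ _)) (insert-unit (e-inverse true) _ _ _)
    inverse-∷ s inv e e-inverse true  false L J =
      trans (*-congʳ (*-assoc _ _ _)) (trans (insert-unit (e-inverse false) _ _ _) (*-congʳ (-1*x≈-x _)))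
    inverse-∷ s inv e e-inverse true  true  L J =
      trans (*-congʳ (*-assoc _ _ _)) (trans (insert-unit (e-inverse true) _ _ _) (*-congʳ (-1*x≈-x _)))

    kostka-inverse : ∀ m s (inv : Vec Bool m → Carrier) → (∀ J → invDenAt s J * inv J ≈ 1#) →
                     Inverses m (KostkaAt s) (λ L J → invNumAt s L J * inv J)
    kostka-inverse zero s inv h =
      inverses-[] (KostkaAt s) (λ L J → invNumAt s L J * inv J)
                  (trans (*-identityˡ _) (trans (*-congʳ (*-identityˡ 1#)) (h [])))
    kostka-inverse (suc m) s inv h =
      inverses-∷ (KostkaAt s) (λ L J → invNumAt s L J * inv J)
                 (kostka₂ (zAt s)) (kostkaInverse₂ (zAt s) e)
                 (λ i → KostkaAt (step i s)) (λ j L J → invNumAt (step j s) L J * inv′ j J)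
                 (kostka-∷ s) (inverse-∷ s inv e e-inverse)
                 (kostka₂-inverse (zAt s) e e-inverse)
                 (λ j → kostka-inverse m (step j s) (inv′ j) (inv′-inverse j))
      where
      inv′ : Bool → Vec Bool m → Carrier
      inv′ j J = dAt s j * inv (j ∷ J)

      inv′-inverse : ∀ j J → invDenAt (step j s) J * inv′ j J ≈ 1#
      inv′-inverse j J = trans (x∙yz≈yx∙z _ _ _) (trans (*-congʳ (sym (invDen-∷ s j J))) (h (j ∷ J)))

      -- dAt s j is a unit since it divides the unit invDenAt s (j ∷ J), for any J.
      e : Bool → Carrier
      e j = invDenAt (step j s) (replicate m false) * inv (j ∷ replicate m false)

      e-inverse : ∀ j → e j * dAt s j ≈ 1#
      e-inverse j = trans (sym (xy∙z≈yz∙x _ _ _)) (trans (*-congʳ (sym (invDen-∷ s j _))) (h _))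

mainTheorem6 : {c ℓ : Level} (R : CommutativeRing c ℓ) (m : ℕ)
    (q t : ℕ → ℕ → CommutativeRing.Carrier R)
    (inv : Vec Bool m → CommutativeRing.Carrier R) →
    (∀ J → CommutativeRing._≈_ R (CommutativeRing._*_ R (invDen R q t J) (inv J)) (CommutativeRing.1# R)) →
    (∀ I J → CommutativeRing._≈_ R
        (matMul R m (Kostka R q t) (λ L J′ → CommutativeRing._*_ R (invNum R q t L J′) (inv J′)) I J)
        (δ R I J))
    × (∀ I J → CommutativeRing._≈_ R
        (matMul R m (λ L J′ → CommutativeRing._*_ R (invNum R q t L J′) (inv J′)) (Kostka R q t) I J)
        (δ R I J))
mainTheorem6 R m q t = kostka-inverse R q t m (0 , 0)
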